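{- Let $q\ge 3$ and $s_1,s_2,s_3\ge 3$ be integers. Then $$R(K_{2s_1-1}^{(3)}-e,\ K_{2s_2-1}^{(3)},\ K_{2s_3-1}^{(3)},\ K_5^{(3)},\ K_{q+1}^{(3)}-e;3)\ >\ q\bigl(R(K_{s_1},K_{s_2},K_{s_3};2)-1\bigr).$$
   Context: $K_m^{(r)}$ denotes the complete $r$-uniform hypergraph on $m$ vertices ($K_m=K_m^{(2)}$), and $K_m^{(3)}-e$ denotes $K_m^{(3)}$ with one hyperedge removed. For $r$-uniform hypergraphs $H_1,\dots,H_t$, the Ramsey number $R(H_1,\dots,H_t;r)$ is the least positive integer $p$ such that every coloring of the hyperedges of $K_p^{(r)}$ with colors $1,\dots,t$ contains, for some $i$, a subhypergraph isomorphic to $H_i$ all of whose hyperedges have color $i$. Here $q$ is just a positive integer (not a field order). -}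

module Defs where

open import Data.Nat using (ℕ; suc; _<_; _≤_; _<?_)
open import Data.Fin using (Fin; toℕ; _≟_)
open import Data.Fin.Properties using (any?)
open import Data.Fin.Subset using (Subset; ∣_∣; _∈_)
open import Data.Fin.Subset.Properties using (_∈?_)
open import Data.Vec using (Vec; tabulate; lookup)
open import Data.Product using (Σ; ∃; _×_)
open import Relation.Nullary using (¬_; does)
open import Relation.Nullary.Decidable using (_×-dec_)
open import Relation.Binary.PropositionalEquality using (_≡_; _≢_)
open import Function.Definitions using (Injective)

record Hypergraph (r : ℕ) : Set₁ where
  field
    m    : ℕ
    Edge : Subset m → Set
    uniform : ∀ e → Edge e → ∣ e ∣ ≡ r
open Hypergraph public

K : (r m : ℕ) → Hypergraph r
K r m = record { m = m ; Edge = λ e → ∣ e ∣ ≡ r ; uniform = λ e p → p }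

first3 : (m : ℕ) → Subset m
first3 m = tabulate (λ x → does (toℕ x <? 3))

-- K_m^{(3)} - e : remove the hyperedge {0,1,2} (which edge is irrelevant up to isomorphism)
K3-e : (m : ℕ) → Hypergraph 3
K3-e m = record { m = m ; Edge = λ e → (∣ e ∣ ≡ 3) × (e ≢ first3 m) ; uniform = λ e p → Data.Product.proj₁ p }

image : {m p : ℕ} → (Fin m → Fin p) → Subset m → Subset p
image f e = tabulate (λ y → does (any? (λ x → (x ∈? e) ×-dec (f x ≟ y))))

-- Colorings of the hyperedges of K_p^{(r)} with colours Fin t are modelled as
-- functions Subset p → Fin t; only their values on r-subsets are ever used.
Arrows : (r p : ℕ) {t : ℕ} → Vec (Hypergraph r) t → Set
Arrows r p {t} Hs =
  (c : Subset p → Fin t) →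
  ∃ λ (i : Fin t) → Σ (Fin (m (lookup Hs i)) → Fin p) λ f →
    Injective _≡_ _≡_ f × (∀ e → Edge (lookup Hs i) e → c (image f e) ≡ i)

IsRamseyNumber : (r : ℕ) {t : ℕ} → Vec (Hypergraph r) t → ℕ → Set
IsRamseyNumber r Hs p = (1 ≤ p) × Arrows r p Hs × (∀ p′ → 1 ≤ p′ → p′ < p → ¬ Arrows r p′ Hs)

-- Let c colour the edges of K_n, n = R(K_s₁, K_s₂, K_s₃) - 1, with no K_sᵢ in colour i, and blow
-- every vertex up into a block of q vertices. A triple inside one block gets the colour of
-- K_{q+1}^(3) - e, a triple meeting exactly two blocks that of K_5^(3), and a triple meeting
-- three blocks the colour under c of its two lower blocks. A copy of K_{q+1}^(3) - e in its
-- colour lies in one block, which is too small; among five vertices some three meet one or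
-- three blocks, so there is no K_5^(3); and in a copy of K_{2s-1}^(3) - e in colour i, the
-- vertices outside the two highest blocks lie in distinct blocks spanning a K_s of colour i
-- under c.

module Submission where

open import Defs
open import Data.Nat using (ℕ; zero; suc; z≤n; s≤s; _+_; _*_; _∸_; _≤_; _<_)
open import Data.Vec using ([]; _∷_)
import Data.Nat.Properties as ℕ
import Data.Bool as Bool
open import Data.Fin as Fin using (Fin; zero; suc; toℕ; #_; _↑ˡ_; punchIn; inject≤)
open import Data.Fin.Properties as Fin using (any?; all?)
open import Data.Fin.Permutation using (Permutation; transpose; _⟨$⟩ʳ_)
open import Data.Fin.Subset using (Subset; ⁅_⁆; _∪_; _∈_; _∉_; ∣_∣; inside; outside)
  renaming (⊥ to ∅)
open import Data.Fin.Subset.Properties using (_∈?_; x∈⁅x⁆; x∈⁅y⁆⇒x≡y; ∣⁅x⁆∣≡1; x∈p∪q⁺; x∈p∪q⁻;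
  ⊆-antisym; ∪-identityˡ; ∪-identityʳ; drop-there)
import Data.List.Extrema as Extrema
open import Data.List.Base using (allFin)
import Data.List.Relation.Unary.All as All
open import Data.List.Membership.Propositional.Properties using (∈-allFin)
open import Data.Vec.Base using (tabulate; here; there)
import Data.Vec.Properties as Vec
open import Data.Product using (Σ; ∃; ∃₂; _×_; _,_; proj₁; proj₂)
open import Data.Product.Properties using (×-≡,≡→≡)
open import Data.Sum as Sum using (_⊎_; inj₁; inj₂; [_,_]′)
open import Function using (_∘_; Injective; Injection; Inverse; case_of_)
open import Function.Properties.Inverse using (↔⇒↣)
open import Relation.Nullary using (¬_; Dec; yes; no; does; contradiction)
open import Relation.Nullary.Decidable using (dec-true; _×-dec_; _→-dec_; ¬?)
open import Relation.Unary using (Pred; Decidable)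
open import Relation.Binary.Definitions using (DecidableEquality)
open import Relation.Binary.PropositionalEquality
open import Level using (Level; 0ℓ)

private
  variable
    a : Level
    A : Set a
    k n : ℕ

∈-tabulate⁺ : {P : Pred (Fin n) 0ℓ} (P? : Decidable P) {x : Fin n} →
              P x → x ∈ tabulate (does ∘ P?)
∈-tabulate⁺ P? {x} px = Vec.lookup⇒[]= x _ (trans (Vec.lookup∘tabulate _ x) (dec-true (P? x) px))

∈-tabulate⁻ : {P : Pred (Fin n) 0ℓ} (P? : Decidable P) {x : Fin n} →
              x ∈ tabulate (does ∘ P?) → P x
∈-tabulate⁻ P? {x} x∈ with P? x | trans (sym (Vec.[]=⇒lookup x∈)) (Vec.lookup∘tabulate _ x)
... | yes px | _ = px
... | no _   | ()

pair : Fin n → Fin n → Subset n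
pair x y = ⁅ x ⁆ ∪ ⁅ y ⁆

triple : Fin n → Fin n → Fin n → Subset n
triple x y z = ⁅ x ⁆ ∪ pair y z

module _ {x y t : Fin n} where

  ∈-pair⁻ : t ∈ pair x y → t ≡ x ⊎ t ≡ y
  ∈-pair⁻ = Sum.map (x∈⁅y⁆⇒x≡y x) (x∈⁅y⁆⇒x≡y y) ∘ x∈p∪q⁻ _ _

  ∈-pair⁺ : t ≡ x ⊎ t ≡ y → t ∈ pair x y
  ∈-pair⁺ (inj₁ refl) = x∈p∪q⁺ (inj₁ (x∈⁅x⁆ t))
  ∈-pair⁺ (inj₂ refl) = x∈p∪q⁺ (inj₂ (x∈⁅x⁆ t))

module _ {x y z t : Fin n} where

  ∈-triple⁻ : t ∈ triple x y z → t ≡ x ⊎ t ≡ y ⊎ t ≡ z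
  ∈-triple⁻ = Sum.map (x∈⁅y⁆⇒x≡y x) ∈-pair⁻ ∘ x∈p∪q⁻ _ _

  ∈-triple⁺ : t ≡ x ⊎ t ≡ y ⊎ t ≡ z → t ∈ triple x y z
  ∈-triple⁺ (inj₁ refl) = x∈p∪q⁺ (inj₁ (x∈⁅x⁆ t))
  ∈-triple⁺ (inj₂ t∈yz) = x∈p∪q⁺ (inj₂ (∈-pair⁺ t∈yz))

Constant Rainbow : A → A → A → Set _
Constant x y z = x ≡ y × x ≡ z
Rainbow x y z = x ≢ y × y ≢ z × x ≢ z

Rainbow-map : ∀ {b} {B : Set b} {f : A → B} → Injective _≡_ _≡_ f →
              ∀ {x y z} → Rainbow x y z → Rainbow (f x) (f y) (f z)
Rainbow-map f-inj (x≢y , y≢z , x≢z) = x≢y ∘ f-inj , y≢z ∘ f-inj , x≢z ∘ f-inj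

∣⁅x⁆∪p∣≡1+∣p∣ : ∀ {x : Fin n} {p} → x ∉ p → ∣ ⁅ x ⁆ ∪ p ∣ ≡ suc ∣ p ∣
∣⁅x⁆∪p∣≡1+∣p∣ {x = zero}  {outside ∷ p} _   = cong (suc ∘ ∣_∣) (∪-identityˡ p)
∣⁅x⁆∪p∣≡1+∣p∣ {x = zero}  {inside  ∷ p} x∉p = contradiction here x∉p
∣⁅x⁆∪p∣≡1+∣p∣ {x = suc x} {outside ∷ p} x∉p = ∣⁅x⁆∪p∣≡1+∣p∣ (x∉p ∘ there)
∣⁅x⁆∪p∣≡1+∣p∣ {x = suc x} {inside  ∷ p} x∉p = cong suc (∣⁅x⁆∪p∣≡1+∣p∣ (x∉p ∘ there))

∣pair∣≡2 : ∀ {x y : Fin n} → x ≢ y → ∣ pair x y ∣ ≡ 2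
∣pair∣≡2 {y = y} x≢y = trans (∣⁅x⁆∪p∣≡1+∣p∣ (x≢y ∘ x∈⁅y⁆⇒x≡y y)) (cong suc (∣⁅x⁆∣≡1 y))

∣triple∣≡3 : ∀ {x y z : Fin n} → Rainbow x y z → ∣ triple x y z ∣ ≡ 3
∣triple∣≡3 (x≢y , y≢z , x≢z) =
  trans (∣⁅x⁆∪p∣≡1+∣p∣ ([ x≢y , x≢z ]′ ∘ ∈-pair⁻)) (cong suc (∣pair∣≡2 y≢z))

∣p∣≡0⇒p≡∅ : (p : Subset n) → ∣ p ∣ ≡ 0 → p ≡ ∅
∣p∣≡0⇒p≡∅ []            _      = refl
∣p∣≡0⇒p≡∅ (outside ∷ p) ∣p∣≡0 = cong (outside ∷_) (∣p∣≡0⇒p≡∅ p ∣p∣≡0)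

split-member : (p : Subset n) → ∣ p ∣ ≡ suc k →
               ∃₂ λ x p′ → x ∉ p′ × p ≡ ⁅ x ⁆ ∪ p′ × ∣ p′ ∣ ≡ k
split-member (inside ∷ p) ∣p∣≡1+k =
  zero , outside ∷ p , (λ ()) , cong (inside ∷_) (sym (∪-identityˡ p)) , ℕ.suc-injective ∣p∣≡1+k
split-member (outside ∷ p) ∣p∣≡1+k with split-member p ∣p∣≡1+k
... | x , p′ , x∉p′ , refl , ∣p′∣≡k = suc x , outside ∷ p′ , x∉p′ ∘ drop-there , refl , ∣p′∣≡k

∣p∣≡2⇒pair : (p : Subset n) → ∣ p ∣ ≡ 2 → ∃₂ λ x y → x ≢ y × p ≡ pair x y
∣p∣≡2⇒pair p ∣p∣≡2 with split-member p ∣p∣≡2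
... | x , p′ , x∉p′ , refl , ∣p′∣≡1 with split-member p′ ∣p′∣≡1
... | y , p″ , _ , refl , ∣p″∣≡0 =
  x , y , (λ { refl → x∉p′ (x∈p∪q⁺ (inj₁ (x∈⁅x⁆ x))) }) ,
  cong (⁅ x ⁆ ∪_) (trans (cong (⁅ y ⁆ ∪_) (∣p∣≡0⇒p≡∅ p″ ∣p″∣≡0)) (∪-identityʳ ⁅ y ⁆))

module _ {m} (f : Fin m → Fin n) where

  private
    hasPreimage? : ∀ e → Decidable (λ y → ∃ λ x → x ∈ e × f x ≡ y)
    hasPreimage? e y = any? λ x → x ∈? e ×-dec f x Fin.≟ y

  ∈-image⁺ : ∀ {e x} → x ∈ e → f x ∈ image f e
  ∈-image⁺ {e} {x} x∈e = ∈-tabulate⁺ (hasPreimage? e) (x , x∈e , refl)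

  ∈-image⁻ : ∀ {e y} → y ∈ image f e → ∃ λ x → x ∈ e × f x ≡ y
  ∈-image⁻ {e} = ∈-tabulate⁻ (hasPreimage? e)

  image-∪ : ∀ p q → image f (p ∪ q) ≡ image f p ∪ image f q
  image-∪ p q = ⊆-antisym ⊆ ⊇
    where
    ⊆ : ∀ {y} → y ∈ image f (p ∪ q) → y ∈ image f p ∪ image f q
    ⊆ y∈ with ∈-image⁻ y∈
    ... | x , x∈p∪q , refl = x∈p∪q⁺ (Sum.map ∈-image⁺ ∈-image⁺ (x∈p∪q⁻ p q x∈p∪q))
    ⊇ : ∀ {y} → y ∈ image f p ∪ image f q → y ∈ image f (p ∪ q)
    ⊇ y∈ with x∈p∪q⁻ (image f p) (image f q) y∈
    ... | inj₁ y∈fp with ∈-image⁻ y∈fp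
    ...   | x , x∈p , refl = ∈-image⁺ (x∈p∪q⁺ (inj₁ x∈p))
    ⊇ y∈ | inj₂ y∈fq with ∈-image⁻ y∈fq
    ...   | x , x∈q , refl = ∈-image⁺ (x∈p∪q⁺ (inj₂ x∈q))

  image-⁅⁆ : ∀ x → image f ⁅ x ⁆ ≡ ⁅ f x ⁆
  image-⁅⁆ x = ⊆-antisym ⊆ ⊇
    where
    ⊆ : ∀ {y} → y ∈ image f ⁅ x ⁆ → y ∈ ⁅ f x ⁆
    ⊆ y∈ with ∈-image⁻ y∈
    ... | x′ , x′∈ , refl rewrite x∈⁅y⁆⇒x≡y x x′∈ = x∈⁅x⁆ (f x)
    ⊇ : ∀ {y} → y ∈ ⁅ f x ⁆ → y ∈ image f ⁅ x ⁆
    ⊇ y∈ rewrite x∈⁅y⁆⇒x≡y (f x) y∈ = ∈-image⁺ (x∈⁅x⁆ x)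

  image-pair : ∀ x y → image f (pair x y) ≡ pair (f x) (f y)
  image-pair x y = trans (image-∪ _ _) (cong₂ _∪_ (image-⁅⁆ x) (image-⁅⁆ y))

  image-triple : ∀ x y z → image f (triple x y z) ≡ triple (f x) (f y) (f z)
  image-triple x y z = trans (image-∪ _ _) (cong₂ _∪_ (image-⁅⁆ x) (image-pair y z))

triple≢first3 : ∀ {x y z : Fin n} → 3 ≤ toℕ z → triple x y z ≢ first3 n
triple≢first3 {z = z} 3≤z eq = ℕ.<⇒≱ (∈-tabulate⁻ (λ x → toℕ x ℕ.<? 3) z∈first3) 3≤z
  where
  z∈first3 : z ∈ first3 _
  z∈first3 = subst (z ∈_) eq (∈-triple⁺ (inj₂ (inj₂ refl)))

avoid-first3 : ∀ {a b t₁ t₂ : Fin n} → t₁ ∉ triple a b t₂ →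
               triple a b t₁ ≢ first3 n ⊎ triple a b t₂ ≢ first3 n
avoid-first3 {a = a} {b} {t₁} {t₂} t₁∉ with Vec.≡-dec Bool._≟_ (triple a b t₁) (first3 _)
... | no ≢first3  = inj₁ ≢first3
... | yes ≡first3 =
  inj₂ λ eq → t₁∉ (subst (t₁ ∈_) (trans ≡first3 (sym eq)) (∈-triple⁺ (inj₂ (inj₂ refl))))

-- Opaque: letting the unifier unfold the fold computing argmax makes its uses very slow to check.
opaque
  maximiser : (g : Fin (suc k) → Fin n) → ∃ λ t → ∀ x → g x Fin.≤ g t
  maximiser {n = n} g =
    argmax g zero (allFin _) ,
    λ x → All.lookup (f[xs]≤f[argmax] {f = g} zero (allFin _)) (∈-allFin x)
    where open Extrema (Fin.≤-totalOrder n)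

-- Homogeneous triples

HomogeneousTriple : (Fin n → A) → Set _
HomogeneousTriple g = ∃₂ λ i j → ∃ λ k →
  Rainbow i j k × (Constant (g i) (g j) (g k) ⊎ Rainbow (g i) (g j) (g k))

HomogeneousTriple-permute : (π : Permutation n n) {g : Fin n → A} →
                            HomogeneousTriple (g ∘ (π ⟨$⟩ʳ_)) → HomogeneousTriple g
HomogeneousTriple-permute π (i , j , k , ijk , shape) =
  π ⟨$⟩ʳ i , π ⟨$⟩ʳ j , π ⟨$⟩ʳ k , Rainbow-map (Injection.injective (↔⇒↣ π)) ijk , shape

module _ (_≟_ : DecidableEquality A) where

  homogeneousTriple-of-pair : (g : Fin 5 → A) → g (# 0) ≡ g (# 1) → HomogeneousTriple g
  homogeneousTriple-of-pair g g01 with g (# 2) ≟ g (# 0) | g (# 3) ≟ g (# 0) | g (# 2) ≟ g (# 3)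
  ... | yes g20 | _       | _       =
    # 0 , # 1 , # 2 , ((λ ()) , (λ ()) , (λ ())) , inj₁ (g01 , sym g20)
  ... | no _    | yes g30 | _       =
    # 0 , # 1 , # 3 , ((λ ()) , (λ ()) , (λ ())) , inj₁ (g01 , sym g30)
  ... | no g20  | no g30  | no g23  =
    # 0 , # 2 , # 3 , ((λ ()) , (λ ()) , (λ ())) , inj₂ (g20 ∘ sym , g23 , g30 ∘ sym)
  ... | no g20  | no _    | yes g23 with g (# 4) ≟ g (# 0) | g (# 4) ≟ g (# 2)
  ...   | yes g40 | _       =
    # 0 , # 1 , # 4 , ((λ ()) , (λ ()) , (λ ())) , inj₁ (g01 , sym g40)
  ...   | no _    | yes g42 =
    # 2 , # 3 , # 4 , ((λ ()) , (λ ()) , (λ ())) , inj₁ (g23 , sym g42)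
  ...   | no g40  | no g42  =
    # 0 , # 2 , # 4 , ((λ ()) , (λ ()) , (λ ())) , inj₂ (g20 ∘ sym , g42 ∘ sym , g40 ∘ sym)

  homogeneousTriple : (g : Fin 5 → A) → HomogeneousTriple g
  homogeneousTriple g with g (# 0) ≟ g (# 1) | g (# 2) ≟ g (# 0) | g (# 2) ≟ g (# 1)
  ... | yes g01 | _       | _       = homogeneousTriple-of-pair g g01
  ... | no _    | yes g20 | _       =
    HomogeneousTriple-permute (transpose (# 1) (# 2)) (homogeneousTriple-of-pair _ (sym g20))
  ... | no _    | no _    | yes g21 =
    HomogeneousTriple-permute (transpose (# 0) (# 2)) (homogeneousTriple-of-pair _ g21)
  ... | no g01  | no g20  | no g21  =
    # 0 , # 1 , # 2 , ((λ ()) , (λ ()) , (λ ())) , inj₂ (g01 , g21 ∘ sym , g20 ∘ sym)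

-- The blown-up colouring

m≤toℕ⇒↑ˡ≢ : ∀ {m} n (j : Fin m) (k : Fin (m + n)) → m ≤ toℕ k → j ↑ˡ n ≢ k
m≤toℕ⇒↑ˡ≢ n j _ m≤k refl = ℕ.<⇒≱ (subst (_< _) (sym (Fin.toℕ-↑ˡ j n)) (Fin.toℕ<n j)) m≤k

blockEmbedding : ∀ {p n q} → p ≤ n * q → Fin p → Fin n × Fin q
blockEmbedding p≤nq x = Inverse.to Fin.*↔× (inject≤ x p≤nq)

blockEmbedding-injective : ∀ {p n q} (p≤nq : p ≤ n * q) → Injective _≡_ _≡_ (blockEmbedding p≤nq)
blockEmbedding-injective {n = n} {q} p≤nq =
  Fin.inject≤-injective p≤nq p≤nq _ _ ∘ Injection.injective (↔⇒↣ (Fin.*↔× {n} {q}))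

module BlowUp {P n q : ℕ} (ι : Fin P → Fin n × Fin q) (ι-injective : Injective _≡_ _≡_ ι)
              (c : Subset n → Fin 3) where

  block : Fin P → Fin n
  block = proj₁ ∘ ι

  SameBlock Collision : Subset P → Set
  SameBlock S = ∀ t u → t ∈ S → u ∈ S → block t ≡ block u
  Collision S = ∃₂ λ t u → t ∈ S × u ∈ S × t ≢ u × block t ≡ block u

  Lower : Subset P → Fin n → Set
  Lower S b = (∃ λ t → t ∈ S × block t ≡ b) × (∃ λ u → u ∈ S × b Fin.< block u)

  sameBlock? : ∀ S → Dec (SameBlock S)
  sameBlock? S = all? λ t → all? λ u → t ∈? S →-dec u ∈? S →-dec block t Fin.≟ block u

  collision? : ∀ S → Dec (Collision S)
  collision? S = any? λ t → any? λ u →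
    t ∈? S ×-dec u ∈? S ×-dec ¬? (t Fin.≟ u) ×-dec block t Fin.≟ block u

  lower? : ∀ S → Decidable (Lower S)
  lower? S b = (any? λ t → t ∈? S ×-dec block t Fin.≟ b) ×-dec
               (any? λ u → u ∈? S ×-dec b Fin.<? block u)

  lowerBlocks : Subset P → Subset n
  lowerBlocks S = tabulate (does ∘ lower? S)

  colour : Subset P → Fin 5
  colour S with sameBlock? S | collision? S
  ... | yes _ | _     = # 4
  ... | no _  | yes _ = # 3
  ... | no _  | no _  = c (lowerBlocks S) ↑ˡ 2

  module _ {x y z : Fin P} (xyz : Rainbow x y z) where

    private
      S = triple x y z
      x∈S : x ∈ S
      x∈S = ∈-triple⁺ (inj₁ refl)
      y∈S : y ∈ S
      y∈S = ∈-triple⁺ (inj₂ (inj₁ refl))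
      z∈S : z ∈ S
      z∈S = ∈-triple⁺ (inj₂ (inj₂ refl))

    constant⇒sameBlock : Constant (block x) (block y) (block z) → SameBlock S
    constant⇒sameBlock (xy , xz) t u t∈S u∈S = trans (toX t∈S) (sym (toX u∈S))
      where
      toX : ∀ {t} → t ∈ S → block t ≡ block x
      toX t∈S with ∈-triple⁻ t∈S
      ... | inj₁ refl        = refl
      ... | inj₂ (inj₁ refl) = sym xy
      ... | inj₂ (inj₂ refl) = sym xz

    rainbow⇒¬collision : Rainbow (block x) (block y) (block z) → ¬ Collision S
    rainbow⇒¬collision (xy , yz , xz) (t , u , t∈S , u∈S , t≢u , tu)
      with ∈-triple⁻ t∈S | ∈-triple⁻ u∈S
    ... | inj₁ refl        | inj₁ refl        = t≢u refl
    ... | inj₁ refl        | inj₂ (inj₁ refl) = xy tu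
    ... | inj₁ refl        | inj₂ (inj₂ refl) = xz tu
    ... | inj₂ (inj₁ refl) | inj₁ refl        = xy (sym tu)
    ... | inj₂ (inj₁ refl) | inj₂ (inj₁ refl) = t≢u refl
    ... | inj₂ (inj₁ refl) | inj₂ (inj₂ refl) = yz tu
    ... | inj₂ (inj₂ refl) | inj₁ refl        = xz (sym tu)
    ... | inj₂ (inj₂ refl) | inj₂ (inj₁ refl) = yz (sym tu)
    ... | inj₂ (inj₂ refl) | inj₂ (inj₂ refl) = t≢u refl

    ¬collision⇒rainbow : ¬ Collision S → Rainbow (block x) (block y) (block z)
    ¬collision⇒rainbow noCollision =
      (λ xy → noCollision (x , y , x∈S , y∈S , proj₁ xyz , xy)) ,
      (λ yz → noCollision (y , z , y∈S , z∈S , proj₁ (proj₂ xyz) , yz)) ,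
      (λ xz → noCollision (x , z , x∈S , z∈S , proj₂ (proj₂ xyz) , xz))

    lowerBlocks-triple : block x Fin.< block z → block y Fin.< block z →
                         lowerBlocks S ≡ pair (block x) (block y)
    lowerBlocks-triple x<z y<z = ⊆-antisym ⊆ ⊇
      where
      ⊆ : ∀ {b} → b ∈ lowerBlocks S → b ∈ pair (block x) (block y)
      ⊆ b∈ with ∈-tabulate⁻ (lower? S) b∈
      ... | (t , t∈S , refl) , (u , u∈S , t<u) with ∈-triple⁻ t∈S
      ...   | inj₁ refl        = ∈-pair⁺ (inj₁ refl)
      ...   | inj₂ (inj₁ refl) = ∈-pair⁺ (inj₂ refl)
      ...   | inj₂ (inj₂ refl) with ∈-triple⁻ u∈S
      ...     | inj₁ refl        = contradiction x<z (ℕ.<-asym t<u)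
      ...     | inj₂ (inj₁ refl) = contradiction y<z (ℕ.<-asym t<u)
      ...     | inj₂ (inj₂ refl) = contradiction t<u (ℕ.<-irrefl refl)
      ⊇ : ∀ {b} → b ∈ pair (block x) (block y) → b ∈ lowerBlocks S
      ⊇ b∈ with ∈-pair⁻ b∈
      ... | inj₁ refl = ∈-tabulate⁺ (lower? S) ((x , x∈S , refl) , (z , z∈S , x<z))
      ... | inj₂ refl = ∈-tabulate⁺ (lower? S) ((y , y∈S , refl) , (z , z∈S , y<z))

    colour≡#4 : colour S ≡ # 4 → Constant (block x) (block y) (block z)
    colour≡#4 h with sameBlock? S | collision? S
    ... | yes same | _     = same x y x∈S y∈S , same x z x∈S z∈S
    colour≡#4 () | no _ | yes _
    ... | no _     | no _  = contradiction h (m≤toℕ⇒↑ˡ≢ 2 _ (# 4) (ℕ.n≤1+n 3))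

    colour≡#3 : colour S ≡ # 3 →
                ¬ Constant (block x) (block y) (block z) × ¬ Rainbow (block x) (block y) (block z)
    colour≡#3 h with sameBlock? S | collision? S
    colour≡#3 () | yes _ | _
    ... | no notSame | yes collision =
      notSame ∘ constant⇒sameBlock , λ rainbow → rainbow⇒¬collision rainbow collision
    ... | no _       | no _          = contradiction h (m≤toℕ⇒↑ˡ≢ 2 _ (# 3) ℕ.≤-refl)

    colour≡↑ˡ : ∀ {j} → colour S ≡ j ↑ˡ 2 →
                Rainbow (block x) (block y) (block z) ×
                (block x Fin.< block z → block y Fin.< block z → c (pair (block x) (block y)) ≡ j)
    colour≡↑ˡ h with sameBlock? S | collision? S
    ... | yes _ | _           = contradiction (sym h) (m≤toℕ⇒↑ˡ≢ 2 _ (# 4) (ℕ.n≤1+n 3))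
    ... | no _  | yes _       = contradiction (sym h) (m≤toℕ⇒↑ˡ≢ 2 _ (# 3) ℕ.≤-refl)
    ... | no _  | no noCollision =
      ¬collision⇒rainbow noCollision ,
      λ x<z y<z → trans (cong c (sym (lowerBlocks-triple x<z y<z))) (Fin.↑ˡ-injective 2 _ _ h)

  colour-triangle : (H : Hypergraph 3) (f : Fin (m H) → Fin P) {i : Fin 5} →
                    (∀ e → Edge H e → colour (image f e) ≡ i) →
                    ∀ a b t → Edge H (triple a b t) → colour (triple (f a) (f b) (f t)) ≡ i
  colour-triangle H f mono a b t edge =
    trans (cong colour (sym (image-triple f a b t))) (mono _ edge)

  no-K5-in-#3 : {f : Fin 5 → Fin P} → Injective _≡_ _≡_ f →
                ¬ (∀ e → Edge (K 3 5) e → colour (image f e) ≡ # 3)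
  no-K5-in-#3 {f} f-inj mono with homogeneousTriple Fin._≟_ (block ∘ f)
  ... | i , j , k , ijk , shape = [ proj₁ notHomogeneous , proj₂ notHomogeneous ]′ shape
    where
    notHomogeneous : ¬ Constant (block (f i)) (block (f j)) (block (f k)) ×
                     ¬ Rainbow (block (f i)) (block (f j)) (block (f k))
    notHomogeneous =
      colour≡#3 (Rainbow-map f-inj ijk) (colour-triangle (K 3 5) f mono i j k (∣triple∣≡3 ijk))

  -- The triangles {0,1,3}, {0,2,3} and {0,1,w} (w ≥ 3) avoid the removed edge, so all vertices
  -- lie in the block of vertex 0 and their positions in it inject m > q vertices into Fin q.
  no-K3-e-in-#4 : ∀ {m} → 4 ≤ m → q < m → {f : Fin m → Fin P} → Injective _≡_ _≡_ f →
                  ¬ (∀ e → Edge (K3-e m) e → colour (image f e) ≡ # 4)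
  no-K3-e-in-#4 (s≤s (s≤s (s≤s (s≤s _)))) q<m {f} f-inj mono =
    Fin.<⇒notInjective q<m position-injective
    where
    inBlock : ∀ {a b w} → Rainbow a b w → 3 ≤ toℕ w →
              Constant (block (f a)) (block (f b)) (block (f w))
    inBlock {a} {b} {w} abw 3≤w = colour≡#4 (Rainbow-map f-inj abw)
      (colour-triangle (K3-e _) f mono a b w (∣triple∣≡3 abw , triple≢first3 3≤w))
    sameBlock : ∀ v → block (f v) ≡ block (f zero)
    sameBlock zero                = refl
    sameBlock (suc zero)          =
      sym (proj₁ (inBlock {zero} {# 1} {# 3} ((λ ()) , (λ ()) , (λ ())) ℕ.≤-refl))
    sameBlock (suc (suc zero))    =
      sym (proj₁ (inBlock {zero} {# 2} {# 3} ((λ ()) , (λ ()) , (λ ())) ℕ.≤-refl))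
    sameBlock (suc (suc (suc v))) =
      sym (proj₂ (inBlock {zero} {# 1} ((λ ()) , (λ ()) , (λ ())) (s≤s (s≤s (s≤s z≤n)))))
    position-injective : Injective _≡_ _≡_ (proj₂ ∘ ι ∘ f)
    position-injective same =
      f-inj (ι-injective (×-≡,≡→≡ (trans (sameBlock _) (sym (sameBlock _)) , same)))

  below-apex : ∀ {m} {f : Fin m → Fin P} {j} → Injective _≡_ _≡_ f →
               (∀ e → Edge (K3-e m) e → colour (image f e) ≡ j ↑ˡ 2) →
               ∀ {a b t} → Rainbow a b t → triple a b t ≢ first3 m →
               block (f a) Fin.≤ block (f t) → block (f b) Fin.≤ block (f t) →
               block (f a) ≢ block (f b) × c (pair (block (f a)) (block (f b))) ≡ j
  below-apex {f = f} f-inj mono {a} {b} {t} abt ≢first3 a≤t b≤t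
    with colour≡↑ˡ (Rainbow-map f-inj abt)
                   (colour-triangle (K3-e _) f mono a b t (∣triple∣≡3 abt , ≢first3))
  ... | (a≢b , b≢t , a≢t) , pairColour =
    a≢b , pairColour (Fin.≤∧≢⇒< a≤t a≢t) (Fin.≤∧≢⇒< b≤t b≢t)

  -- The vertices in the two highest blocks serve as apexes: for any two other vertices one of
  -- the two triangles through them and an apex is an edge of K3-e.
  clique : ∀ {s m} {j : Fin 3} → 2 + s ≤ m → {f : Fin m → Fin P} → Injective _≡_ _≡_ f →
           (∀ e → Edge (K3-e m) e → colour (image f e) ≡ j ↑ˡ 2) →
           Σ (Fin s → Fin n) λ h → Injective _≡_ _≡_ h × (∀ e → ∣ e ∣ ≡ 2 → c (image h e) ≡ j)
  clique {s} {suc (suc k)} {j} (s≤s (s≤s s≤k)) {f} f-inj mono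
    with maximiser (block ∘ f)
  ... | top₁ , below-top₁′ with maximiser (block ∘ f ∘ punchIn top₁)
  ... | top₂′ , below-top₂′ = h , h-injective , h-colour
    where
    height : Fin (2 + k) → Fin n
    height = block ∘ f

    top₂ : Fin (2 + k)
    top₂ = punchIn top₁ top₂′

    others : Fin s → Fin (2 + k)
    others u = punchIn top₁ (punchIn top₂′ (inject≤ u s≤k))

    h : Fin s → Fin n
    h = height ∘ others

    others-injective : Injective _≡_ _≡_ others
    others-injective {u} {v} =
      Fin.inject≤-injective s≤k s≤k u v ∘ Fin.punchIn-injective top₂′ _ _
        ∘ Fin.punchIn-injective top₁ _ _

    others≢top₁ : ∀ u → others u ≢ top₁
    others≢top₁ u = Fin.punchInᵢ≢i top₁ _

    others≢top₂ : ∀ u → others u ≢ top₂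
    others≢top₂ u = Fin.punchInᵢ≢i top₂′ _ ∘ Fin.punchIn-injective top₁ _ _

    below-top₁ : ∀ u → height (others u) Fin.≤ height top₁
    below-top₁ u = below-top₁′ (others u)

    below-top₂ : ∀ u → height (others u) Fin.≤ height top₂
    below-top₂ u = below-top₂′ (punchIn top₂′ (inject≤ u s≤k))

    rainbow : ∀ {u v t} → u ≢ v → (∀ w → others w ≢ t) → Rainbow (others u) (others v) t
    rainbow {u} {v} u≢v others≢t = u≢v ∘ others-injective , others≢t v , others≢t u

    pairColour : ∀ {u v} → u ≢ v → h u ≢ h v × c (pair (h u) (h v)) ≡ j
    pairColour {u} {v} u≢v =
      [ (λ ≢first3 → below-apex f-inj mono (rainbow u≢v others≢top₁) ≢first3
                                (below-top₁ u) (below-top₁ v))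
      , (λ ≢first3 → below-apex f-inj mono (rainbow u≢v others≢top₂) ≢first3
                                (below-top₂ u) (below-top₂ v))
      ]′ (avoid-first3 top₁∉)
      where
      top₁∉ : top₁ ∉ triple (others u) (others v) top₂
      top₁∉ = [ others≢top₁ u ∘ sym , [ others≢top₁ v ∘ sym , Fin.punchInᵢ≢i top₁ top₂′ ∘ sym ]′ ]′
            ∘ ∈-triple⁻

    h-injective : Injective _≡_ _≡_ h
    h-injective {u} {v} hu≡hv with u Fin.≟ v
    ... | yes u≡v = u≡v
    ... | no u≢v  = contradiction hu≡hv (proj₁ (pairColour u≢v))

    h-colour : ∀ e → ∣ e ∣ ≡ 2 → c (image h e) ≡ j
    h-colour e ∣e∣≡2 with ∣p∣≡2⇒pair e ∣e∣≡2
    ... | u , v , u≢v , refl = trans (cong c (image-pair h u v)) (proj₂ (pairColour u≢v))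

2+s≤2*s∸1 : ∀ {s} → 3 ≤ s → 2 + s ≤ 2 * s ∸ 1
2+s≤2*s∸1 {s} 3≤s =
  ℕ.∸-monoˡ-≤ 1 (subst (3 + s ≤_) (cong (s +_) (sym (ℕ.+-identityʳ s))) (ℕ.+-monoˡ-≤ s 3≤s))

1≤m*n⇒1≤n : ∀ m {n} → 1 ≤ m * n → 1 ≤ n
1≤m*n⇒1≤n m {zero}  1≤m*0 = contradiction (subst (1 ≤_) (ℕ.*-zeroʳ m) 1≤m*0) λ ()
1≤m*n⇒1≤n m {suc n} _     = s≤s z≤n

blowUp-arrows : ∀ {p n q s₁ s₂ s₃} → 3 ≤ q → 3 ≤ s₁ → 3 ≤ s₂ → 3 ≤ s₃ → p ≤ n * q →
  Arrows 3 p (K3-e (2 * s₁ ∸ 1) ∷ K 3 (2 * s₂ ∸ 1) ∷ K 3 (2 * s₃ ∸ 1) ∷ K 3 5 ∷ K3-e (q + 1) ∷ []) →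
  Arrows 2 n (K 2 s₁ ∷ K 2 s₂ ∷ K 2 s₃ ∷ [])
blowUp-arrows {q = q} 3≤q 3≤s₁ 3≤s₂ 3≤s₃ p≤nq arrows c = case arrows colour of λ where
    (zero , f , f-inj , mono) →
      zero , clique (2+s≤2*s∸1 3≤s₁) f-inj mono
    (suc zero , f , f-inj , mono) →
      suc zero , clique (2+s≤2*s∸1 3≤s₂) f-inj (λ e → mono e ∘ proj₁)
    (suc (suc zero) , f , f-inj , mono) →
      suc (suc zero) , clique (2+s≤2*s∸1 3≤s₃) f-inj (λ e → mono e ∘ proj₁)
    (suc (suc (suc zero)) , f , f-inj , mono) →
      contradiction mono (no-K5-in-#3 f-inj)
    (suc (suc (suc (suc zero))) , f , f-inj , mono) →
      contradiction mono (no-K3-e-in-#4 (ℕ.+-monoˡ-≤ 1 3≤q) (ℕ.m<m+n q (s≤s z≤n)) f-inj)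
  where open BlowUp (blockEmbedding p≤nq) (blockEmbedding-injective p≤nq) c

theorem13 : (q s₁ s₂ s₃ : ℕ) → 3 ≤ q → 3 ≤ s₁ → 3 ≤ s₂ → 3 ≤ s₃ →
    (R N : ℕ) →
    IsRamseyNumber 3 (K3-e (2 * s₁ ∸ 1) ∷ K 3 (2 * s₂ ∸ 1) ∷ K 3 (2 * s₃ ∸ 1) ∷ K 3 5 ∷ K3-e (q + 1) ∷ []) R →
    IsRamseyNumber 2 (K 2 s₁ ∷ K 2 s₂ ∷ K 2 s₃ ∷ []) N →
    q * (N ∸ 1) < R
theorem13 q s₁ s₂ s₃ 3≤q 3≤s₁ 3≤s₂ 3≤s₃ R zero    _                  (() , _)
theorem13 q s₁ s₂ s₃ 3≤q 3≤s₁ 3≤s₂ 3≤s₃ R (suc n) (1≤R , arrowsR , _) (_ , _ , minimal) =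
  ℕ.≰⇒> λ R≤q*n → minimal n (1≤m*n⇒1≤n q (ℕ.≤-trans 1≤R R≤q*n)) (ℕ.n<1+n n)
    (blowUp-arrows 3≤q 3≤s₁ 3≤s₂ 3≤s₃ (subst (R ≤_) (ℕ.*-comm q n) R≤q*n) arrowsR)
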